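{- Let $(G_n)_{n\in\mathbb N}$ be a sequence of pairwise nonisomorphic finite graphs and let $M_n=\max\{\mathrm{c\text{ - }rk}\,G_n,\mathrm{c\text{ - }rk}\,\overline{G_n}\}$. Then $\lim_{n\to+\infty}M_n=+\infty$.
   Context: Graphs are finite, undirected, without loops or multiple edges; $\overline H$ denotes the complement graph (same vertices, distinct vertices adjacent iff not adjacent in $H$). $\mathrm{c\text{ - }rk}\,H$ is the maximum number of independent columns of the boolean matrix $A^c_H$ indexed by the vertices (entry $0$ if $\{i,j\}$ is an edge of $H$, else $1$), where vectors over the superboolean semiring $\{0,1,1^\nu\}$ (with $0+x=x$, $1+1=1^\nu$, $1^\nu+x=1^\nu$, $0\cdot x=0$, $1\cdot1=1$, $1\cdot1^\nu=1^\nu\cdot1^\nu=1^\nu$) are dependent if some $\{0,1\}$-combination with not all coefficients zero has all coordinates in $\{0,1^\nu\}$, independent otherwise. -}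

module Defs where

open import Data.Nat using (ℕ; zero; suc; _≤_; _⊔_)
open import Data.Fin using (Fin; zero; suc; _≟_)
open import Data.Bool using (Bool; true; false; not)
open import Data.Vec using (lookup)
open import Data.Fin.Subset using (Subset; _⊆_; Nonempty; ∣_∣)
open import Data.Product using (Σ; ∃; _×_; _,_)
open import Function.Bundles using (_↔_; Inverse)
open import Relation.Nullary using (¬_; yes; no)
open import Relation.Binary.PropositionalEquality using (_≡_; refl; sym)
import Data.Empty

record Graph : Set where
  field
    size  : ℕ
    Adj   : Fin size → Fin size → Bool
    symm  : ∀ i j → Adj i j ≡ Adj j i
    irrefl : ∀ i → Adj i i ≡ false
open Graph public

_≅_ : Graph → Graph → Set
G ≅ H = Σ (Fin (size G) ↔ Fin (size H)) λ f →
          ∀ i j → Adj G i j ≡ Adj H (Inverse.to f i) (Inverse.to f j)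

coAdj : ∀ {n} → (Fin n → Fin n → Bool) → Fin n → Fin n → Bool
coAdj a i j with i ≟ j
... | yes _ = false
... | no _  = not (a i j)

coAdj-sym : ∀ {n} (a : Fin n → Fin n → Bool) → (∀ i j → a i j ≡ a j i) →
            ∀ i j → coAdj a i j ≡ coAdj a j i
coAdj-sym a s i j with i ≟ j | j ≟ i
... | yes _ | yes _ = refl
... | yes refl | no q = ⊥-elim' (q refl)
  where ⊥-elim' : ∀ {A : Set} → Data.Empty.⊥ → A
        ⊥-elim' ()
... | no p | yes refl = ⊥-elim' (p refl)
  where ⊥-elim' : ∀ {A : Set} → Data.Empty.⊥ → A
        ⊥-elim' ()
... | no _ | no _ rewrite s i j = refl

coAdj-irrefl : ∀ {n} (a : Fin n → Fin n → Bool) → ∀ i → coAdj a i i ≡ false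
coAdj-irrefl a i with i ≟ i
... | yes _ = refl
... | no p = ⊥-elim' (p refl)
  where ⊥-elim' : ∀ {A : Set} → Data.Empty.⊥ → A
        ⊥-elim' ()

complement : Graph → Graph
complement G = record
  { size = size G
  ; Adj = coAdj (Adj G)
  ; symm = coAdj-sym (Adj G) (symm G)
  ; irrefl = coAdj-irrefl (Adj G)
  }

-- Superboolean semiring {0, 1, 1^ν}

data SB : Set where
  𝟘 𝟙 𝟙ν : SB

_⊕_ : SB → SB → SB
𝟘  ⊕ x = x
𝟙  ⊕ 𝟘 = 𝟙
𝟙  ⊕ 𝟙 = 𝟙ν
𝟙  ⊕ 𝟙ν = 𝟙ν
𝟙ν ⊕ _ = 𝟙ν

_⊗_ : SB → SB → SB
𝟘  ⊗ _ = 𝟘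
𝟙  ⊗ 𝟘 = 𝟘
𝟙  ⊗ 𝟙 = 𝟙
𝟙  ⊗ 𝟙ν = 𝟙ν
𝟙ν ⊗ 𝟘 = 𝟘
𝟙ν ⊗ _ = 𝟙ν

∑ : ∀ {n} → (Fin n → SB) → SB
∑ {zero}  f = 𝟘
∑ {suc n} f = f zero ⊕ ∑ (λ i → f (suc i))

coef : Bool → SB
coef true  = 𝟙
coef false = 𝟘

Ac : (H : Graph) → Fin (size H) → Fin (size H) → SB
Ac H i j with Adj H i j
... | true  = 𝟘
... | false = 𝟙

comb : (H : Graph) → Subset (size H) → Fin (size H) → SB
comb H T i = ∑ (λ j → coef (lookup T j) ⊗ Ac H i j)

-- The columns indexed by S are independent: no {0,1}-combination of them
-- with not all coefficients zero has all coordinates in {0, 1^ν},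
-- i.e. every such combination has some coordinate equal to 1.
IndepCols : (H : Graph) → Subset (size H) → Set
IndepCols H S = ∀ T → T ⊆ S → Nonempty T → ∃ λ i → comb H T i ≡ 𝟙

IsCRk : Graph → ℕ → Set
IsCRk H r = (∃ λ S → IndepCols H S × ∣ S ∣ ≡ r)
          × (∀ S → IndepCols H S → ∣ S ∣ ≤ r)

{-# OPTIONS --safe #-}
-- A clique S of H gives |S| independent columns of A^c_H: in a nonempty {0,1}-combination
-- of them, the coordinate at any chosen column x of the combination is exactly 1, since
-- A^c_H has 1 on the diagonal and 0 between adjacent vertices. An independent set of G is a
-- clique of its complement, so if both c-ranks of G are below K, Ramsey's theorem bounds the
-- number of vertices of G by R(K,K). Graphs of bounded size fall into finitely many
-- isomorphism classes (code a graph by its size and its adjacency matrix padded to a fixed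
-- size), hence only finitely many of the pairwise nonisomorphic G_n have M_n < K. Passing
-- from "finitely many exceptions" to "eventually" is the one classical step, which is why
-- the conclusion is double-negated.
module Submission where

open import Defs
open import Data.Bool using (Bool; true; false)
open import Data.Nat using (ℕ; zero; suc; _+_; _*_; _^_; _≤_; _<_; _⊔_; z≤n; s≤s; s≤s⁻¹; _≤?_; _<?_)
open import Data.Nat.Properties
  using (≤-trans; ≤-<-trans; module ≤-Reasoning; ≤-reflexive; +-suc; +-monoˡ-≤; +-cancelˡ-≤;
         m≤m⊔n; m≤n⊔m; <⇒≤; ≰⇒>; ≮⇒≥; <⇒≱; n<1+n; m≤n⇒m≤1+n)
open import Data.Fin using (Fin; zero; suc; toℕ; fromℕ<; inject≤; combine; funToFin; finToFun)
import Data.Fin.Properties as Fin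
open import Data.Fin.Subset
  using (Subset; inside; outside; _∈_; _⊆_; Nonempty; ∣_∣; ⊥; ⊤; ⁅_⁆; _∪_; _∩_; ∁; _-_)
open import Data.Fin.Subset.Properties
  using (∉⊥; ⊥⊆; ∣⊤∣≡n; ∣⊥∣≡0; x∈⁅x⁆; x∈⁅y⁆⇒x≡y; x∉⁅y⁆⇒x≢y; x∈∁p⇒x∉p;
         x∈p∩q⁻; ∣p∩q∣≤∣q∣; ∣⁅x⁆∣≡1; p⊆q⇒∣p∣≤∣q∣; x∈p∪q⁺; x∈p∪q⁻;
         x∈p∧x≢y⇒x∈p-y; x∈p⇒∣p-x∣<∣p∣; nonempty?; Empty-unique)
open import Data.Vec using ([]; _∷_; lookup; tabulate)
open import Data.Vec.Properties using (lookup∘tabulate; []=⇒lookup; lookup⇒[]=)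
open import Data.Vec.Functional as Vector using (Vector)
open import Data.Vec.Functional.Relation.Unary.All using (All)
open import Data.Maybe using (Maybe; just; nothing)
open import Data.Product using (∃; ∃₂; _×_; _,_; proj₁; proj₂)
open import Data.Sum using (_⊎_; inj₁; inj₂; [_,_])
open import Function using (_∘_)
open import Function.Bundles using (Injection; _↣_)
open import Function.Definitions using (Injective)
open import Function.Properties.Inverse using (↔-refl; ↔-sym; ↔⇒↣)
open import Relation.Nullary using (¬_; yes; no; contradiction)
open import Relation.Nullary.Negation using (¬¬-map)
open import Relation.Binary.PropositionalEquality
  using (_≡_; _≢_; refl; sym; trans; cong; subst; module ≡-Reasoning)

private
  variable
    n : ℕ

m+n≤o+p⇒m≤o⊎n≤p : ∀ {m n o p} → m + n ≤ o + p → m ≤ o ⊎ n ≤ p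
m+n≤o+p⇒m≤o⊎n≤p {m} {n} {o} {p} le with m ≤? o
... | yes m≤o = inj₁ m≤o
... | no  m≰o = inj₂ (<⇒≤ (+-cancelˡ-≤ o (suc n) p (begin
  o + suc n ≡⟨ +-suc o n ⟩
  suc o + n ≤⟨ +-monoˡ-≤ n (≰⇒> m≰o) ⟩
  m + n     ≤⟨ le ⟩
  o + p     ∎)))
  where open ≤-Reasoning

∣p∣≡∣p∩q∣+∣p∩∁q∣ : (p q : Subset n) → ∣ p ∣ ≡ ∣ p ∩ q ∣ + ∣ p ∩ ∁ q ∣
∣p∣≡∣p∩q∣+∣p∩∁q∣ []            []            = refl
∣p∣≡∣p∩q∣+∣p∩∁q∣ (outside ∷ p) (_       ∷ q) = ∣p∣≡∣p∩q∣+∣p∩∁q∣ p q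
∣p∣≡∣p∩q∣+∣p∩∁q∣ (inside  ∷ p) (inside  ∷ q) = cong suc (∣p∣≡∣p∩q∣+∣p∩∁q∣ p q)
∣p∣≡∣p∩q∣+∣p∩∁q∣ (inside  ∷ p) (outside ∷ q) =
  trans (cong suc (∣p∣≡∣p∩q∣+∣p∩∁q∣ p q)) (sym (+-suc _ _))

∣p∣>0⇒Nonempty : (p : Subset n) → 0 < ∣ p ∣ → Nonempty p
∣p∣>0⇒Nonempty {n} p 0<∣p∣ with nonempty? p
... | yes nonempty = nonempty
... | no empty     =
  contradiction (subst (0 <_) (trans (cong ∣_∣ (Empty-unique empty)) (∣⊥∣≡0 n)) 0<∣p∣) λ ()

Homogeneous : (Fin n → Fin n → Bool) → Bool → Subset n → Set
Homogeneous a b S = ∀ {i j} → i ∈ S → j ∈ S → i ≢ j → a i j ≡ b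

HasHomogeneous : (Fin n → Fin n → Bool) → Bool → ℕ → Subset n → Set
HasHomogeneous a b k U = ∃ λ S → S ⊆ U × k ≤ ∣ S ∣ × Homogeneous a b S

ramseyBound : ℕ → ℕ → ℕ
ramseyBound zero    t       = 0
ramseyBound (suc s) zero    = 0
ramseyBound (suc s) (suc t) = suc (ramseyBound s (suc t) + ramseyBound (suc s) t)

colourClass : (Fin n → Fin n → Bool) → Fin n → Bool → Subset n
colourClass a v true  = tabulate (a v)
colourClass a v false = ∁ (tabulate (a v))

neighbours : (Fin n → Fin n → Bool) → Bool → Fin n → Subset n → Subset n
neighbours a b v U = (U ∩ ∁ ⁅ v ⁆) ∩ colourClass a v b

module _ (a : Fin n → Fin n → Bool) where

  ∈colourClass⁻ : ∀ {v j} b → j ∈ colourClass a v b → a v j ≡ b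
  ∈colourClass⁻ {v} {j} true  j∈C = trans (sym (lookup∘tabulate (a v) j)) ([]=⇒lookup j∈C)
  ∈colourClass⁻ {v} {j} false j∈C with a v j in avj
  ... | false = refl
  ... | true  = contradiction (lookup⇒[]= j _ (trans (lookup∘tabulate (a v) j) avj)) (x∈∁p⇒x∉p j∈C)

  ∣U∣≤1+∣neighbours∣ : ∀ v U → ∣ U ∣ ≤ suc (∣ neighbours a true v U ∣ + ∣ neighbours a false v U ∣)
  ∣U∣≤1+∣neighbours∣ v U = begin
    ∣ U ∣
      ≡⟨ ∣p∣≡∣p∩q∣+∣p∩∁q∣ U ⁅ v ⁆ ⟩
    ∣ U ∩ ⁅ v ⁆ ∣ + ∣ U ∩ ∁ ⁅ v ⁆ ∣
      ≤⟨ +-monoˡ-≤ _ (≤-trans (∣p∩q∣≤∣q∣ U ⁅ v ⁆) (≤-reflexive (∣⁅x⁆∣≡1 v))) ⟩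
    suc ∣ U ∩ ∁ ⁅ v ⁆ ∣
      ≡⟨ cong suc (∣p∣≡∣p∩q∣+∣p∩∁q∣ (U ∩ ∁ ⁅ v ⁆) (tabulate (a v))) ⟩
    suc (∣ neighbours a true v U ∣ + ∣ neighbours a false v U ∣) ∎
    where open ≤-Reasoning

  neighbours⊆ : ∀ {b v U} → neighbours a b v U ⊆ U
  neighbours⊆ = proj₁ ∘ x∈p∩q⁻ _ _ ∘ proj₁ ∘ x∈p∩q⁻ _ _

  emptyHomogeneous : ∀ {b} U → HasHomogeneous a b 0 U
  emptyHomogeneous U = ⊥ , ⊥⊆ , z≤n , λ i∈⊥ → contradiction i∈⊥ ∉⊥

  HasHomogeneous-mono : ∀ {b k U V} → U ⊆ V → HasHomogeneous a b k U → HasHomogeneous a b k V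
  HasHomogeneous-mono U⊆V (S , S⊆U , k≤∣S∣ , hom) = S , U⊆V ∘ S⊆U , k≤∣S∣ , hom

  HasHomogeneous-extend : (∀ i j → a i j ≡ a j i) → ∀ {b k v U} → v ∈ U →
    HasHomogeneous a b k (neighbours a b v U) → HasHomogeneous a b (suc k) U
  HasHomogeneous-extend symm {b} {k} {v} {U} v∈U (S , S⊆N , k≤∣S∣ , hom) =
    ⁅ v ⁆ ∪ S , ⁅v⁆∪S⊆U , k<∣⁅v⁆∪S∣ , ⁅v⁆∪S-homogeneous
    where
    inN : ∀ {j} → j ∈ S → j ∈ U × j ≢ v × a v j ≡ b
    inN j∈S with x∈p∩q⁻ _ _ (S⊆N j∈S)
    ... | j∈U∖v , j∈C with x∈p∩q⁻ _ _ j∈U∖v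
    ... | j∈U , j∈∁v = j∈U , x∉⁅y⁆⇒x≢y (x∈∁p⇒x∉p j∈∁v) , ∈colourClass⁻ b j∈C
    ⁅v⁆∪S⊆U : ⁅ v ⁆ ∪ S ⊆ U
    ⁅v⁆∪S⊆U j∈⁅v⁆∪S with x∈p∪q⁻ ⁅ v ⁆ S j∈⁅v⁆∪S
    ... | inj₁ j∈v = subst (_∈ U) (sym (x∈⁅y⁆⇒x≡y v j∈v)) v∈U
    ... | inj₂ j∈S = proj₁ (inN j∈S)
    k<∣⁅v⁆∪S∣ : k < ∣ ⁅ v ⁆ ∪ S ∣
    k<∣⁅v⁆∪S∣ = ≤-<-trans k≤∣S∣ (≤-<-trans (p⊆q⇒∣p∣≤∣q∣ S⊆⁅v⁆∪S-v) (x∈p⇒∣p-x∣<∣p∣ v∈⁅v⁆∪S))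
      where
      v∈⁅v⁆∪S : v ∈ ⁅ v ⁆ ∪ S
      v∈⁅v⁆∪S = x∈p∪q⁺ (inj₁ (x∈⁅x⁆ v))
      S⊆⁅v⁆∪S-v : S ⊆ ⁅ v ⁆ ∪ S - v
      S⊆⁅v⁆∪S-v j∈S = x∈p∧x≢y⇒x∈p-y (x∈p∪q⁺ (inj₂ j∈S)) (proj₁ (proj₂ (inN j∈S)))
    ⁅v⁆∪S-homogeneous : Homogeneous a b (⁅ v ⁆ ∪ S)
    ⁅v⁆∪S-homogeneous {i} {j} i∈⁅v⁆∪S j∈⁅v⁆∪S i≢j
      with x∈p∪q⁻ ⁅ v ⁆ S i∈⁅v⁆∪S | x∈p∪q⁻ ⁅ v ⁆ S j∈⁅v⁆∪S
    ... | inj₂ i∈S | inj₂ j∈S = hom i∈S j∈S i≢j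
    ... | inj₁ i∈v | inj₂ j∈S rewrite x∈⁅y⁆⇒x≡y v i∈v = proj₂ (proj₂ (inN j∈S))
    ... | inj₂ i∈S | inj₁ j∈v rewrite x∈⁅y⁆⇒x≡y v j∈v = trans (symm i v) (proj₂ (proj₂ (inN i∈S)))
    ... | inj₁ i∈v | inj₁ j∈v = contradiction (trans (x∈⁅y⁆⇒x≡y v i∈v) (sym (x∈⁅y⁆⇒x≡y v j∈v))) i≢j

  ramsey : (∀ i j → a i j ≡ a j i) →
    ∀ s t (U : Subset n) → ramseyBound s t ≤ ∣ U ∣ →
    HasHomogeneous a true s U ⊎ HasHomogeneous a false t U
  ramsey symm zero    t       U _     = inj₁ (emptyHomogeneous U)
  ramsey symm (suc s) zero    U _     = inj₂ (emptyHomogeneous U)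
  ramsey symm (suc s) (suc t) U bound
    with v , v∈U ← ∣p∣>0⇒Nonempty U (≤-trans (s≤s z≤n) bound)
    with m+n≤o+p⇒m≤o⊎n≤p (s≤s⁻¹ (≤-trans bound (∣U∣≤1+∣neighbours∣ v U)))
  ... | inj₁ enough = [ inj₁ ∘ HasHomogeneous-extend symm v∈U
                       , inj₂ ∘ HasHomogeneous-mono (neighbours⊆ {b = true}) ]
                       (ramsey symm s (suc t) (neighbours a true v U) enough)
  ... | inj₂ enough = [ inj₁ ∘ HasHomogeneous-mono (neighbours⊆ {b = false})
                       , inj₂ ∘ HasHomogeneous-extend symm v∈U ]
                       (ramsey symm (suc s) t (neighbours a false v U) enough)

∑-zero : (f : Fin n → SB) → (∀ j → f j ≡ 𝟘) → ∑ f ≡ 𝟘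
∑-zero {zero}  f f≡𝟘 = refl
∑-zero {suc n} f f≡𝟘 rewrite f≡𝟘 zero = ∑-zero (f ∘ suc) (f≡𝟘 ∘ suc)

∑-unit : (f : Fin n → SB) (x : Fin n) → f x ≡ 𝟙 → (∀ j → j ≢ x → f j ≡ 𝟘) → ∑ f ≡ 𝟙
∑-unit {suc n} f zero    fx≡𝟙 f≡𝟘
  rewrite fx≡𝟙 | ∑-zero (f ∘ suc) (λ j → f≡𝟘 (suc j) λ ()) = refl
∑-unit {suc n} f (suc x) fx≡𝟙 f≡𝟘
  rewrite f≡𝟘 zero (λ ()) =
  ∑-unit (f ∘ suc) x fx≡𝟙 (λ j j≢x → f≡𝟘 (suc j) (j≢x ∘ Fin.suc-injective))

Ac-edge : (H : Graph) {i j : Fin (size H)} → Adj H i j ≡ true → Ac H i j ≡ 𝟘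
Ac-edge H adj rewrite adj = refl

Ac-diagonal : (H : Graph) (i : Fin (size H)) → Ac H i i ≡ 𝟙
Ac-diagonal H i rewrite irrefl H i = refl

clique⇒IndepCols : (H : Graph) {S : Subset (size H)} → Homogeneous (Adj H) true S → IndepCols H S
clique⇒IndepCols H clique T T⊆S (x , x∈T) = x , ∑-unit _ x diagonal offDiagonal
  where
  diagonal : coef (lookup T x) ⊗ Ac H x x ≡ 𝟙
  diagonal rewrite []=⇒lookup x∈T | Ac-diagonal H x = refl
  offDiagonal : ∀ j → j ≢ x → coef (lookup T j) ⊗ Ac H x j ≡ 𝟘
  offDiagonal j j≢x with lookup T j in Tj
  ... | false = refl
  ... | true  rewrite Ac-edge H (clique (T⊆S x∈T) (T⊆S (lookup⇒[]= j T Tj)) (j≢x ∘ sym)) = refl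

independent⇒clique-complement : (G : Graph) {S : Subset (size G)} →
  Homogeneous (Adj G) false S → Homogeneous (Adj (complement G)) true S
independent⇒clique-complement G independent {i} {j} i∈S j∈S i≢j with i Fin.≟ j
... | yes i≡j = contradiction i≡j i≢j
... | no  _   rewrite independent i∈S j∈S i≢j = refl

clique-size≤c-rk : (H : Graph) {c : ℕ} {S : Subset (size H)} →
  IsCRk H c → Homogeneous (Adj H) true S → ∣ S ∣ ≤ c
clique-size≤c-rk H (_ , maximal) clique = maximal _ (clique⇒IndepCols H clique)

ramseyBound≤size⇒K≤c⊔c' : (H : Graph) {c c' : ℕ} (K : ℕ) → ramseyBound K K ≤ size H →
  IsCRk H c → IsCRk (complement H) c' → K ≤ c ⊔ c'
ramseyBound≤size⇒K≤c⊔c' H {c} {c'} K big crk crk'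
  with ramsey (Adj H) (symm H) K K ⊤ (subst (ramseyBound K K ≤_) (sym (∣⊤∣≡n (size H))) big)
... | inj₁ (S , _ , K≤∣S∣ , clique) =
  ≤-trans K≤∣S∣ (≤-trans (clique-size≤c-rk H crk clique) (m≤m⊔n c c'))
... | inj₂ (S , _ , K≤∣S∣ , independent) =
  ≤-trans K≤∣S∣ (≤-trans (clique-size≤c-rk (complement H) crk' (independent⇒clique-complement H independent))
                         (m≤n⊔m c c'))

restrict : ∀ {m} → Fin n → Maybe (Fin m)
restrict {m = m} i with toℕ i <? m
... | yes i<m = just (fromℕ< i<m)
... | no  _   = nothing

restrict-inject≤ : ∀ {m} (i : Fin m) (m≤n : m ≤ n) → restrict (inject≤ i m≤n) ≡ just i
restrict-inject≤ {m = m} i m≤n with toℕ (inject≤ i m≤n) <? m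
... | yes i<m = cong just (Fin.toℕ-injective (trans (Fin.toℕ-fromℕ< i<m) (Fin.toℕ-inject≤ i m≤n)))
... | no  i≮m = contradiction (subst (_< m) (sym (Fin.toℕ-inject≤ i m≤n)) (Fin.toℕ<n i)) i≮m

padAdj : ∀ {m} → (Fin m → Fin m → Bool) → Fin n → Fin n → Bool
padAdj a i j with restrict i | restrict j
... | just i' | just j' = a i' j'
... | _       | _       = false

padAdj-inject≤ : ∀ {m} (a : Fin m → Fin m → Bool) (m≤n : m ≤ n) (i j : Fin m) →
  padAdj a (inject≤ i m≤n) (inject≤ j m≤n) ≡ a i j
padAdj-inject≤ a m≤n i j rewrite restrict-inject≤ i m≤n | restrict-inject≤ j m≤n = refl

funToFin-injective : ∀ {m} (f g : Fin m → Fin n) → funToFin f ≡ funToFin g → ∀ i → f i ≡ g i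
funToFin-injective f g eq i = begin
  f i                     ≡⟨ sym (Fin.finToFun-funToFin f i) ⟩
  finToFun (funToFin f) i ≡⟨ cong (λ k → finToFun k i) eq ⟩
  finToFun (funToFin g) i ≡⟨ Fin.finToFun-funToFin g i ⟩
  g i                     ∎
  where open ≡-Reasoning

bool↣fin2 : Bool ↣ Fin 2
bool↣fin2 = ↔⇒↣ (↔-sym Fin.2↔Bool)

adjacencyCode : (Fin n → Fin n → Bool) → Fin ((2 ^ n) ^ n)
adjacencyCode a = funToFin λ i → funToFin λ j → Injection.to bool↣fin2 (a i j)

adjacencyCode-injective : (a a' : Fin n → Fin n → Bool) →
  adjacencyCode a ≡ adjacencyCode a' → ∀ i j → a i j ≡ a' i j
adjacencyCode-injective a a' eq i j =
  Injection.injective bool↣fin2 (funToFin-injective _ _ (funToFin-injective _ _ eq i) j)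

samePadding⇒≅ : (G G' : Graph) → size G ≡ size G' → size G ≤ n →
  (∀ i j → padAdj {n = n} (Adj G) i j ≡ padAdj (Adj G') i j) → G ≅ G'
samePadding⇒≅ G G' refl m≤n samePad = ↔-refl , λ i j → begin
  Adj G i j                                   ≡⟨ sym (padAdj-inject≤ (Adj G) m≤n i j) ⟩
  padAdj (Adj G) (inject≤ i m≤n) (inject≤ j m≤n)  ≡⟨ samePad _ _ ⟩
  padAdj (Adj G') (inject≤ i m≤n) (inject≤ j m≤n) ≡⟨ padAdj-inject≤ (Adj G') m≤n i j ⟩
  Adj G' i j                                  ∎
  where open ≡-Reasoning

graphCodeBound : ℕ → ℕ
graphCodeBound B = B * (2 ^ B) ^ B

graphCode : ∀ {B} (G : Graph) → size G < B → Fin (graphCodeBound B)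
graphCode {B} G size<B = combine (fromℕ< size<B) (adjacencyCode {n = B} (padAdj (Adj G)))

graphCode-injective : ∀ {B} (G G' : Graph) (p : size G < B) (p' : size G' < B) →
  graphCode G p ≡ graphCode G' p' → G ≅ G'
graphCode-injective {B} G G' p p' eq with Fin.combine-injective _ _ _ _ eq
... | sameSize , sameAdjacency =
  samePadding⇒≅ {n = B} G G'
    (trans (sym (Fin.toℕ-fromℕ< p)) (trans (cong toℕ sameSize) (Fin.toℕ-fromℕ< p')))
    (<⇒≤ p)
    (adjacencyCode-injective (padAdj (Adj G)) (padAdj (Adj G')) sameAdjacency)

isomorphicPair : ∀ B (G : Fin (suc (graphCodeBound B)) → Graph) → (∀ i → size (G i) < B) →
  ∃₂ λ i j → i ≢ j × G i ≅ G j
isomorphicPair B G small with Fin.pigeonhole (n<1+n _) (λ i → graphCode (G i) (small i))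
... | i , j , i<j , sameCode =
  i , j , Fin.<⇒≢ i<j , graphCode-injective (G i) (G j) (small i) (small j) sameCode

∷⁺ : ∀ {A : Set} {k} (Q : A → Set) {x} {xs : Vector A k} → Q x → All Q xs → All Q (x Vector.∷ xs)
∷⁺ Q Qx Qxs zero    = Qx
∷⁺ Q Qx Qxs (suc i) = Qxs i

∷-injective : ∀ {k L n} {f : Vector ℕ k} → All (_< L) f → L ≤ n →
  Injective _≡_ _≡_ f → Injective _≡_ _≡_ (n Vector.∷ f)
∷-injective f<L L≤n injective {zero}  {zero}  _  = refl
∷-injective f<L L≤n injective {zero}  {suc j} eq = contradiction (subst (_ ≤_) eq L≤n) (<⇒≱ (f<L j))
∷-injective f<L L≤n injective {suc i} {zero}  eq =
  contradiction (subst (_ ≤_) (sym eq) L≤n) (<⇒≱ (f<L i))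
∷-injective f<L L≤n injective {suc i} {suc j} eq = cong suc (injective eq)

module _ {P : ℕ → Set} where

  distinctWitnesses : (∀ N → ¬ ¬ (∃ λ n → N ≤ n × P n)) →
    ∀ k → ¬ ¬ (∃₂ λ L (f : Vector ℕ k) → All (_< L) f × Injective _≡_ _≡_ f × All P f)
  distinctWitnesses frequently zero    none = none (0 , (λ ()) , (λ ()) , (λ { {()} }) , λ ())
  distinctWitnesses frequently (suc k) none =
    -- the new witness is taken above the bound L of the old ones, so it is distinct from them
    distinctWitnesses frequently k λ (L , f , f<L , injective , Pf) →
    frequently L λ (n , L≤n , Pn) →
    none ( suc n , n Vector.∷ f
         , ∷⁺ (_< suc n) (n<1+n n) (λ i → ≤-trans (f<L i) (m≤n⇒m≤1+n L≤n))
         , ∷-injective f<L L≤n injective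
         , ∷⁺ P Pn Pf )

  ¬¬-eventually-¬ : ∀ k → (∀ (f : Vector ℕ k) → Injective _≡_ _≡_ f → ¬ All P f) →
    ¬ ¬ (∃ λ N → ∀ n → N ≤ n → ¬ P n)
  ¬¬-eventually-¬ k fewWitnesses notEventually =
    distinctWitnesses frequently k λ (_ , f , _ , injective , Pf) → fewWitnesses f injective Pf
    where
    frequently : ∀ N → ¬ ¬ (∃ λ n → N ≤ n × P n)
    frequently N noneAbove = notEventually (N , λ n N≤n Pn → noneAbove (n , N≤n , Pn))

proposition9p3 : (G : ℕ → Graph) →
    (∀ m n → m ≢ n → ¬ (G m ≅ G n)) →
    (c c' : ℕ → ℕ) →
    (∀ n → IsCRk (G n) (c n)) →
    (∀ n → IsCRk (complement (G n)) (c' n)) →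
    ∀ K → ¬ ¬ (∃ λ N → ∀ n → N ≤ n → K ≤ c n ⊔ c' n)
proposition9p3 G nonIsomorphic c c' crk crk' K =
  ¬¬-map (λ (N , notSmall) → N , λ n N≤n → ≮⇒≥ (notSmall n N≤n))
         (¬¬-eventually-¬ (suc (graphCodeBound B)) fewSmall)
  where
  B : ℕ
  B = ramseyBound K K
  Small : ℕ → Set
  Small n = c n ⊔ c' n < K
  size<B : ∀ n → Small n → size (G n) < B
  size<B n small =
    ≰⇒> λ B≤size → <⇒≱ small (ramseyBound≤size⇒K≤c⊔c' (G n) K B≤size (crk n) (crk' n))
  fewSmall : ∀ f → Injective _≡_ _≡_ f → ¬ All Small f
  fewSmall f injective small
    with i , j , i≢j , iso ← isomorphicPair B (G ∘ f) (λ i → size<B (f i) (small i))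
    = nonIsomorphic (f i) (f j) (i≢j ∘ injective) iso
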